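{- Let $m\ge 1$ and let $A$ be a $(2m+1)\times(2m+1)$ centrosymmetric $(0,1)$-matrix, and let $x=a_{m+1,m+1}$ be its central entry. Then there exists a centrosymmetric permutation matrix $P$ with $P\le A$ (entrywise) if and only if $x=1$ and the $2m\times 2m$ matrix $A'$ obtained from $A$ by deleting row $m+1$ and column $m+1$ satisfies $\beta_{\pi}(A')=2m$.
   Context: For an $n\times n$ matrix $A=[a_{ij}]$, $A^{\pi}$ denotes the matrix whose $(i,j)$ entry is $a_{n+1-i,n+1-j}$ (rotation by 180 degrees); $A$ is centrosymmetric if $A^{\pi}=A$. A set of rows and columns of an $n\times n$ matrix is $\pi$-invariant if it is invariant under the map sending row $i$ to row $n+1-i$ and column $j$ to column $n+1-j$. A centrosymmetric cover of a $(0,1)$-matrix $A$ is a $\pi$-invariant set of rows and columns that together contain all the $1$'s of $A$; $\beta_{\pi}(A)$ denotes the minimum cardinality of a centrosymmetric cover of $A$. -}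

module Defs where

open import Data.Nat using (ℕ; suc; _+_; _≤_)
open import Data.Bool using (Bool; true)
open import Data.Fin using (Fin; opposite; punchIn; _↑ˡ_; fromℕ)
open import Data.Fin.Subset using (Subset; _∈_; ∣_∣)
open import Data.Fin.Permutation using (Permutation′; _⟨$⟩ʳ_)
open import Data.Product using (Σ; _×_; ∃)
open import Data.Sum using (_⊎_)
open import Relation.Binary.PropositionalEquality using (_≡_)
open import Function.Bundles using (_⇔_)

Matrix01 : ℕ → Set
Matrix01 n = Fin n → Fin n → Bool

-- π on indices: i ↦ n+1-i (1-based), i.e. i ↦ n-1-i (0-based) = opposite.
-- A^π
_^π : ∀ {n} → Matrix01 n → Matrix01 n
(A ^π) i j = A (opposite i) (opposite j)

Centrosymmetric : ∀ {n} → Matrix01 n → Set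
Centrosymmetric A = ∀ i j → (A ^π) i j ≡ A i j

_≤ₘ_ : ∀ {n} → Matrix01 n → Matrix01 n → Set
P ≤ₘ A = ∀ i j → P i j ≡ true → A i j ≡ true

IsPermutationMatrix : ∀ {n} → Matrix01 n → Set
IsPermutationMatrix {n} P =
  Σ (Permutation′ n) λ σ → ∀ i j → (P i j ≡ true) ⇔ (σ ⟨$⟩ʳ i ≡ j)

PiInvariant : ∀ {n} → Subset n → Subset n → Set
PiInvariant R C = (∀ i → i ∈ R → opposite i ∈ R) × (∀ j → j ∈ C → opposite j ∈ C)

Covers : ∀ {n} → Matrix01 n → Subset n → Subset n → Set
Covers A R C = ∀ i j → A i j ≡ true → (i ∈ R) ⊎ (j ∈ C)

CentroCover : ∀ {n} → Matrix01 n → Subset n → Subset n → Set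
CentroCover A R C = PiInvariant R C × Covers A R C

βπ-is : ∀ {n} → Matrix01 n → ℕ → Set
βπ-is {n} A k =
  (Σ (Subset n) λ R → Σ (Subset n) λ C → CentroCover A R C × (∣ R ∣ + ∣ C ∣ ≡ k))
  × (∀ R C → CentroCover A R C → k ≤ ∣ R ∣ + ∣ C ∣)

-- central index m (0-based) of Fin (2m+1) = Fin (suc (m + m)); 1-based it is m+1.
mid : (m : ℕ) → Fin (suc (m + m))
mid m = fromℕ m ↑ˡ m

deleteMid : (m : ℕ) → Matrix01 (suc (m + m)) → Matrix01 (m + m)
deleteMid m A i j = A (punchIn (mid m) i) (punchIn (mid m) j)

-- If P ≤ A is a centrosymmetric permutation matrix, its permutation commutes with the reflection
-- i ↦ n+1-i, whose only fixed point is the centre; so it fixes the centre (x = 1) and restricts to a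
-- permutation inside A′, and no fewer than 2m lines cover a permutation, so β_π(A′) = 2m.
-- Conversely, fold A′ along the reflection into the m×m matrix whose column q merges the two
-- columns q and π(q). A cover of the folded matrix unfolds to a π-invariant cover of A′ of twice its
-- size, so β_π(A′) = 2m leaves the folded matrix with no cover by fewer than m lines. By König's
-- theorem it has a perfect matching, which unfolds to a centrosymmetric permutation inside A′ and,
-- together with the centre, to one inside A.

module Submission where

open import Defs
open import Algebra.Properties.CommutativeSemigroup using (interchange)
open import Data.Bool using (true; false; _∨_; if_then_else_)
open import Data.Bool.Properties using (∨-zeroʳ) renaming (_≟_ to _≟ᵇ_)
open import Data.Fin using (Fin; zero; suc; toℕ; fromℕ; inject₁; opposite; punchIn; punchOut; _↑ˡ_; _↑ʳ_; splitAt)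
open import Data.Fin.Permutation using (Permutation; Permutation′; _⟨$⟩ʳ_; permutation; insert; remove; insert-punchIn; punchIn-permute)
open import Data.Fin.Properties
  using (_≟_; suc-injective; 0≢1+n; toℕ-injective; toℕ-fromℕ; toℕ-↑ˡ; toℕ-↑ʳ; toℕ<n; opposite-prop; opposite-involutive;
         splitAt-↑ˡ; splitAt-↑ʳ; splitAt⁻¹-↑ˡ; splitAt⁻¹-↑ʳ; punchIn-injective; punchIn-punchOut; punchOut-injective;
         injective⇒≤; any?; all?)
open import Data.Fin.Subset using (Subset; inside; outside; _∈_; _∉_; ∣_∣; _∪_; _∩_; _─_; _-_; ⁅_⁆; ⊤; ⊥; _⊆_; Nonempty)
open import Data.Fin.Subset.Properties
  using (_∈?_; _⊆?_; nonempty?; anySubset?; ∈⊤; ∉⊥; ∣⊤∣≡n; ∣⊥∣≡0; ∣⁅x⁆∣≡1; x∈⁅x⁆; x∈⁅y⁆⇒x≡y; x∉⁅y⁆⇒x≢y; drop-there;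
         x∈p∪q⁺; x∈p∪q⁻; x∈p∩q⁺; x∈p∩q⁻; x∈p∧x∉q⇒x∈p─q; x∈p∧x≢y⇒x∈p-y; p─q⊆p; p⊆q⇒∣p∣≤∣q∣; ∣p∩q∣≤∣p∣; ∣p∣≤∣x∷p∣;
         x∈p⇒∣p-x∣<∣p∣; p∩q≢∅⇒∣p─q∣<∣p∣)
open import Data.Nat using (ℕ; zero; suc; _+_; _∸_; _≤_; _<_; z≤n; s≤s; _≤?_; _<?_)
open import Data.Nat.Properties
  using (≤-refl; ≤-trans; <-≤-trans; n≤1+n; m≤m+n; 1+n≰n; <⇒≱; ≮⇒≥; +-comm; +-assoc; +-suc; +-identityʳ; +-∸-assoc; m+n∸m≡n;
         +-mono-≤; +-monoˡ-≤; +-monoʳ-≤; +-mono-<; +-monoˡ-<; +-monoʳ-<; +-commutativeSemigroup; module ≤-Reasoning)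
open import Data.Product using (Σ; ∃; _×_; _,_; proj₁; proj₂)
import Data.Product as Prod
open import Data.Product.Function.NonDependent.Propositional using (_×-⇔_)
open import Data.Sum using (_⊎_; inj₁; inj₂; [_,_]′)
import Data.Sum as Sum
open import Data.Vec using (Vec; []; _∷_; here; there; _∷ʳ_; _++_; reverse; lookup)
open import Data.Vec.Properties using (reverse-∷; lookup-++ˡ; lookup-++ʳ; []=⇒lookup; lookup⇒[]=)
open import Function using (_∘_; id)
open import Function.Bundles using (_⇔_; mk⇔; Equivalence; Injection)
open import Function.Definitions using (Injective)
import Function.Properties.Equivalence as ⇔
open import Function.Properties.Inverse using (↔⇒↣)
open import Relation.Nullary using (Dec; yes; no; does; contradiction; ¬_)
open import Relation.Nullary.Decidable using (_×-dec_; _⊎-dec_; _→-dec_; dec-true; does-⇔)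
open import Relation.Binary.PropositionalEquality

opposite-injective : ∀ {n} {i j : Fin n} → opposite i ≡ opposite j → i ≡ j
opposite-injective {i = i} {j} e = trans (sym (opposite-involutive i)) (trans (cong opposite e) (opposite-involutive j))

punchIn-fromℕ : ∀ {n} (j : Fin n) → punchIn (fromℕ n) j ≡ inject₁ j
punchIn-fromℕ zero    = refl
punchIn-fromℕ (suc j) = cong suc (punchIn-fromℕ j)

punchIn-inject₁-fromℕ : ∀ {n} (i : Fin (suc n)) → punchIn (inject₁ i) (fromℕ n) ≡ fromℕ (suc n)
punchIn-inject₁-fromℕ         zero    = refl
punchIn-inject₁-fromℕ {suc n} (suc i) = cong suc (punchIn-inject₁-fromℕ i)

punchIn-inject₁ : ∀ {n} (i : Fin (suc n)) (j : Fin n) → punchIn (inject₁ i) (inject₁ j) ≡ inject₁ (punchIn i j)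
punchIn-inject₁ zero    j       = refl
punchIn-inject₁ (suc i) zero    = refl
punchIn-inject₁ (suc i) (suc j) = cong suc (punchIn-inject₁ i j)

opposite-punchIn : ∀ {n} (i : Fin (suc n)) (j : Fin n) → opposite (punchIn i j) ≡ punchIn (opposite i) (opposite j)
opposite-punchIn         zero    j       = sym (punchIn-fromℕ (opposite j))
opposite-punchIn {suc n} (suc i) zero    = sym (punchIn-inject₁-fromℕ (opposite i))
opposite-punchIn {suc n} (suc i) (suc j) = trans (cong inject₁ (opposite-punchIn i j)) (sym (punchIn-inject₁ (opposite i) (opposite j)))

opposite-↑ˡ : ∀ {m} (p : Fin m) → opposite (p ↑ˡ m) ≡ m ↑ʳ opposite p
opposite-↑ˡ {m} p = toℕ-injective (begin
  toℕ (opposite (p ↑ˡ m))  ≡⟨ opposite-prop (p ↑ˡ m) ⟩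
  m + m ∸ suc (toℕ (p ↑ˡ m)) ≡⟨ cong (λ k → m + m ∸ suc k) (toℕ-↑ˡ p m) ⟩
  m + m ∸ suc (toℕ p)      ≡⟨ +-∸-assoc m (toℕ<n p) ⟩
  m + (m ∸ suc (toℕ p))    ≡⟨ cong (m +_) (opposite-prop p) ⟨
  m + toℕ (opposite p)     ≡⟨ toℕ-↑ʳ m (opposite p) ⟨
  toℕ (m ↑ʳ opposite p)    ∎)
  where open ≡-Reasoning

toℕ-mid : ∀ m → toℕ (mid m) ≡ m
toℕ-mid m = trans (toℕ-↑ˡ (fromℕ m) m) (toℕ-fromℕ m)

opposite-mid : ∀ m → opposite (mid m) ≡ mid m
opposite-mid m = toℕ-injective (begin
  toℕ (opposite (mid m))        ≡⟨ opposite-prop (mid m) ⟩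
  suc (m + m) ∸ suc (toℕ (mid m)) ≡⟨ cong (m + m ∸_) (toℕ-mid m) ⟩
  m + m ∸ m                     ≡⟨ m+n∸m≡n m m ⟩
  m                             ≡⟨ toℕ-mid m ⟨
  toℕ (mid m)                   ∎)
  where open ≡-Reasoning

opposite-punchIn-mid : ∀ m (i : Fin (m + m)) → opposite (punchIn (mid m) i) ≡ punchIn (mid m) (opposite i)
opposite-punchIn-mid m i = trans (opposite-punchIn (mid m) i) (cong (λ c → punchIn c (opposite i)) (opposite-mid m))

lookup-∷ʳ-fromℕ : ∀ {A : Set} {n} (xs : Vec A n) x → lookup (xs ∷ʳ x) (fromℕ n) ≡ x
lookup-∷ʳ-fromℕ []       x = refl
lookup-∷ʳ-fromℕ (y ∷ xs) x = lookup-∷ʳ-fromℕ xs x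

lookup-∷ʳ-inject₁ : ∀ {A : Set} {n} (xs : Vec A n) x i → lookup (xs ∷ʳ x) (inject₁ i) ≡ lookup xs i
lookup-∷ʳ-inject₁ (y ∷ xs) x zero    = refl
lookup-∷ʳ-inject₁ (y ∷ xs) x (suc i) = lookup-∷ʳ-inject₁ xs x i

lookup-reverse : ∀ {A : Set} {n} (xs : Vec A n) i → lookup (reverse xs) (opposite i) ≡ lookup xs i
lookup-reverse (x ∷ xs) zero    = trans (cong (λ ys → lookup ys (fromℕ _)) (reverse-∷ x xs)) (lookup-∷ʳ-fromℕ (reverse xs) x)
lookup-reverse (x ∷ xs) (suc i) = begin
  lookup (reverse (x ∷ xs)) (inject₁ (opposite i)) ≡⟨ cong (λ ys → lookup ys (inject₁ (opposite i))) (reverse-∷ x xs) ⟩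
  lookup (reverse xs ∷ʳ x) (inject₁ (opposite i))  ≡⟨ lookup-∷ʳ-inject₁ (reverse xs) x (opposite i) ⟩
  lookup (reverse xs) (opposite i)                 ≡⟨ lookup-reverse xs i ⟩
  lookup xs i                                      ∎
  where open ≡-Reasoning

∣p∪q∣≤∣p∣+∣q∣ : ∀ {n} (p q : Subset n) → ∣ p ∪ q ∣ ≤ ∣ p ∣ + ∣ q ∣
∣p∪q∣≤∣p∣+∣q∣ []            []            = z≤n
∣p∪q∣≤∣p∣+∣q∣ (inside  ∷ p) (inside  ∷ q) = s≤s (≤-trans (∣p∪q∣≤∣p∣+∣q∣ p q) (+-monoʳ-≤ ∣ p ∣ (n≤1+n ∣ q ∣)))
∣p∪q∣≤∣p∣+∣q∣ (inside  ∷ p) (outside ∷ q) = s≤s (∣p∪q∣≤∣p∣+∣q∣ p q)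
∣p∪q∣≤∣p∣+∣q∣ (outside ∷ p) (inside  ∷ q) = subst (suc ∣ p ∪ q ∣ ≤_) (sym (+-suc (∣ p ∣) (∣ q ∣))) (s≤s (∣p∪q∣≤∣p∣+∣q∣ p q))
∣p∪q∣≤∣p∣+∣q∣ (outside ∷ p) (outside ∷ q) = ∣p∪q∣≤∣p∣+∣q∣ p q

∣p∩q∣+∣p─q∣≡∣p∣ : ∀ {n} (p q : Subset n) → ∣ p ∩ q ∣ + ∣ p ─ q ∣ ≡ ∣ p ∣
∣p∩q∣+∣p─q∣≡∣p∣ []            []            = refl
∣p∩q∣+∣p─q∣≡∣p∣ (inside  ∷ p) (inside  ∷ q) = cong suc (∣p∩q∣+∣p─q∣≡∣p∣ p q)
∣p∩q∣+∣p─q∣≡∣p∣ (inside  ∷ p) (outside ∷ q) = trans (+-suc _ _) (cong suc (∣p∩q∣+∣p─q∣≡∣p∣ p q))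
∣p∩q∣+∣p─q∣≡∣p∣ (outside ∷ p) (inside  ∷ q) = ∣p∩q∣+∣p─q∣≡∣p∣ p q
∣p∩q∣+∣p─q∣≡∣p∣ (outside ∷ p) (outside ∷ q) = ∣p∩q∣+∣p─q∣≡∣p∣ p q

∣p++q∣≡∣p∣+∣q∣ : ∀ {a b} (p : Subset a) (q : Subset b) → ∣ p ++ q ∣ ≡ ∣ p ∣ + ∣ q ∣
∣p++q∣≡∣p∣+∣q∣ []            q = refl
∣p++q∣≡∣p∣+∣q∣ (inside  ∷ p) q = cong suc (∣p++q∣≡∣p∣+∣q∣ p q)
∣p++q∣≡∣p∣+∣q∣ (outside ∷ p) q = ∣p++q∣≡∣p∣+∣q∣ p q

∣p∷ʳx∣≡∣x∷p∣ : ∀ {n} (p : Subset n) x → ∣ p ∷ʳ x ∣ ≡ ∣ x ∷ p ∣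
∣p∷ʳx∣≡∣x∷p∣ []            x       = refl
∣p∷ʳx∣≡∣x∷p∣ (outside ∷ p) x       = ∣p∷ʳx∣≡∣x∷p∣ p x
∣p∷ʳx∣≡∣x∷p∣ (inside  ∷ p) inside  = cong suc (∣p∷ʳx∣≡∣x∷p∣ p inside)
∣p∷ʳx∣≡∣x∷p∣ (inside  ∷ p) outside = cong suc (∣p∷ʳx∣≡∣x∷p∣ p outside)

∣reverse[p]∣≡∣p∣ : ∀ {n} (p : Subset n) → ∣ reverse p ∣ ≡ ∣ p ∣
∣reverse[p]∣≡∣p∣ []            = refl
∣reverse[p]∣≡∣p∣ (inside  ∷ p) =
  trans (cong ∣_∣ (reverse-∷ inside p)) (trans (∣p∷ʳx∣≡∣x∷p∣ (reverse p) inside) (cong suc (∣reverse[p]∣≡∣p∣ p)))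
∣reverse[p]∣≡∣p∣ (outside ∷ p) =
  trans (cong ∣_∣ (reverse-∷ outside p)) (trans (∣p∷ʳx∣≡∣x∷p∣ (reverse p) outside) (∣reverse[p]∣≡∣p∣ p))

x∈p─q⇒x∉q : ∀ {n} {x : Fin n} (p q : Subset n) → x ∈ p ─ q → x ∉ q
x∈p─q⇒x∉q (inside ∷ p) (outside ∷ q) here        ()
x∈p─q⇒x∉q (_      ∷ p) (_       ∷ q) (there x∈p─q) (there x∈q) = x∈p─q⇒x∉q p q x∈p─q x∈q

∣⁅x⁆∪p∣≤1+∣p∣ : ∀ {n} (x : Fin n) (p : Subset n) → ∣ ⁅ x ⁆ ∪ p ∣ ≤ suc ∣ p ∣
∣⁅x⁆∪p∣≤1+∣p∣ x p = subst (λ k → ∣ ⁅ x ⁆ ∪ p ∣ ≤ k + ∣ p ∣) (∣⁅x⁆∣≡1 x) (∣p∪q∣≤∣p∣+∣q∣ ⁅ x ⁆ p)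

m+m≤n+n⇒m≤n : ∀ {m n} → m + m ≤ n + n → m ≤ n
m+m≤n+n⇒m≤n m+m≤n+n = ≮⇒≥ λ n<m → <⇒≱ (+-mono-< n<m n<m) m+m≤n+n

-- König's theorem

injective⇒≤-cover : ∀ {a b} (f : Fin a → Fin b) → Injective _≡_ _≡_ f →
                    (R : Subset a) (C : Subset b) → (∀ i → i ∈ R ⊎ f i ∈ C) → a ≤ ∣ R ∣ + ∣ C ∣
injective⇒≤-cover {zero}  f f-inj []      C covered = z≤n
injective⇒≤-cover {suc a} f f-inj (r ∷ R) C covered with covered zero
... | inj₁ here = s≤s (injective⇒≤-cover (f ∘ suc) (suc-injective ∘ f-inj) R C (Sum.map₁ drop-there ∘ covered ∘ suc))
... | inj₂ f0∈C = begin
  suc a                           ≤⟨ s≤s (injective⇒≤-cover (f ∘ suc) (suc-injective ∘ f-inj) R (C - f zero) covered′) ⟩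
  suc (∣ R ∣ + ∣ C - f zero ∣)     ≡⟨ +-suc ∣ R ∣ _ ⟨
  ∣ R ∣ + suc ∣ C - f zero ∣       ≤⟨ +-mono-≤ (∣p∣≤∣x∷p∣ r R) (x∈p⇒∣p-x∣<∣p∣ f0∈C) ⟩
  ∣ r ∷ R ∣ + ∣ C ∣                ∎
  where
  open ≤-Reasoning
  covered′ : ∀ i → i ∈ R ⊎ f (suc i) ∈ C - f zero
  covered′ i = Sum.map drop-there (λ fi∈C → x∈p∧x≢y⇒x∈p-y fi∈C (0≢1+n ∘ sym ∘ f-inj)) (covered (suc i))

-- Halmos–Vaughan induction on the rows L to be matched into the columns K. If some nonempty proper
-- R ⊆ L with some C covers L × K by at most ∣ L ∣ lines (a critical cover), the rows L ─ R must go
-- into C and the rows R outside C, and the two smaller problems are solved separately. Otherwise any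
-- edge u v may be used greedily: a deficient cover of L - u against K - v, extended by u and v, would
-- be critical.
module König {n : ℕ} (E : Matrix01 n) where

  CoversWithin : Subset n → Subset n → Subset n → Subset n → Set
  CoversWithin L K R C = ∀ i j → i ∈ L → j ∈ K → E i j ≡ true → i ∈ R ⊎ j ∈ C

  Matching : Subset n → Subset n → (Fin n → Fin n) → Set
  Matching L K f = (∀ i → i ∈ L → f i ∈ K × E i (f i) ≡ true)
                 × (∀ i j → i ∈ L → j ∈ L → f i ≡ f j → i ≡ j)

  Matchable : Subset n → Subset n → Set
  Matchable L K = Σ (Fin n → Fin n) (Matching L K)

  DeficientCover : Subset n → Subset n → Set
  DeficientCover L K = Σ (Subset n) λ R → Σ (Subset n) λ C → CoversWithin L K R C × ∣ R ∣ + ∣ C ∣ < ∣ L ∣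

  CriticalCover : Subset n → Subset n → Set
  CriticalCover L K = Σ (Subset n) λ R → Σ (Subset n) λ C →
    CoversWithin L K R C × ∣ R ∣ + ∣ C ∣ ≤ ∣ L ∣ × R ⊆ L × Nonempty R × ∣ R ∣ < ∣ L ∣

  coversWithin? : ∀ L K R C → Dec (CoversWithin L K R C)
  coversWithin? L K R C = all? λ i → all? λ j →
    i ∈? L →-dec j ∈? K →-dec E i j ≟ᵇ true →-dec (i ∈? R ⊎-dec j ∈? C)

  criticalCover? : ∀ L K → Dec (CriticalCover L K)
  criticalCover? L K = anySubset? λ R → anySubset? λ C →
    coversWithin? L K R C ×-dec ∣ R ∣ + ∣ C ∣ ≤? ∣ L ∣ ×-dec R ⊆? L ×-dec nonempty? R ×-dec ∣ R ∣ <? ∣ L ∣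

  deficient-outside : ∀ {L K R C} → CoversWithin L K R C → R ⊆ L →
                      DeficientCover (L ─ R) (C ∩ K) → DeficientCover L K
  deficient-outside {L} {K} {R} {C} cov R⊆L (R₁ , C₁ , cov₁ , small₁) = R ∪ R₁ , C₁ , cov′ , size
    where
    cov′ : CoversWithin L K (R ∪ R₁) C₁
    cov′ i j i∈L j∈K e with i ∈? R
    ... | yes i∈R = inj₁ (x∈p∪q⁺ (inj₁ i∈R))
    ... | no  i∉R with cov i j i∈L j∈K e
    ...   | inj₁ i∈R = contradiction i∈R i∉R
    ...   | inj₂ j∈C = Sum.map₁ (λ i∈R₁ → x∈p∪q⁺ (inj₂ i∈R₁))
                         (cov₁ i j (x∈p∧x∉q⇒x∈p─q i∈L i∉R) (x∈p∩q⁺ (j∈C , j∈K)) e)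
    size : ∣ R ∪ R₁ ∣ + ∣ C₁ ∣ < ∣ L ∣
    size = begin-strict
      ∣ R ∪ R₁ ∣ + ∣ C₁ ∣        ≤⟨ +-monoˡ-≤ ∣ C₁ ∣ (∣p∪q∣≤∣p∣+∣q∣ R R₁) ⟩
      ∣ R ∣ + ∣ R₁ ∣ + ∣ C₁ ∣    ≡⟨ +-assoc (∣ R ∣) (∣ R₁ ∣) (∣ C₁ ∣) ⟩
      ∣ R ∣ + (∣ R₁ ∣ + ∣ C₁ ∣)  <⟨ +-monoʳ-< ∣ R ∣ small₁ ⟩
      ∣ R ∣ + ∣ L ─ R ∣          ≤⟨ +-monoˡ-≤ ∣ L ─ R ∣ (p⊆q⇒∣p∣≤∣q∣ (λ x∈R → x∈p∩q⁺ (R⊆L x∈R , x∈R))) ⟩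
      ∣ L ∩ R ∣ + ∣ L ─ R ∣      ≡⟨ ∣p∩q∣+∣p─q∣≡∣p∣ L R ⟩
      ∣ L ∣                      ∎
      where open ≤-Reasoning

  deficient-inside : ∀ {L K R C} → CoversWithin L K R C → ∣ R ∣ + ∣ C ∣ ≤ ∣ L ∣ →
                     DeficientCover R (K ─ C) → DeficientCover L K
  deficient-inside {L} {K} {R} {C} cov tight (R₂ , C₂ , cov₂ , small₂) = R₂ , C₂ ∪ C , cov′ , size
    where
    cov′ : CoversWithin L K R₂ (C₂ ∪ C)
    cov′ i j i∈L j∈K e with j ∈? C
    ... | yes j∈C = inj₂ (x∈p∪q⁺ (inj₂ j∈C))
    ... | no  j∉C with cov i j i∈L j∈K e
    ...   | inj₂ j∈C = contradiction j∈C j∉C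
    ...   | inj₁ i∈R = Sum.map₂ (λ j∈C₂ → x∈p∪q⁺ (inj₁ j∈C₂))
                         (cov₂ i j i∈R (x∈p∧x∉q⇒x∈p─q j∈K j∉C) e)
    size : ∣ R₂ ∣ + ∣ C₂ ∪ C ∣ < ∣ L ∣
    size = begin-strict
      ∣ R₂ ∣ + ∣ C₂ ∪ C ∣        ≤⟨ +-monoʳ-≤ ∣ R₂ ∣ (∣p∪q∣≤∣p∣+∣q∣ C₂ C) ⟩
      ∣ R₂ ∣ + (∣ C₂ ∣ + ∣ C ∣)  ≡⟨ +-assoc (∣ R₂ ∣) (∣ C₂ ∣) (∣ C ∣) ⟨
      ∣ R₂ ∣ + ∣ C₂ ∣ + ∣ C ∣    <⟨ +-monoˡ-< ∣ C ∣ small₂ ⟩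
      ∣ R ∣ + ∣ C ∣              ≤⟨ tight ⟩
      ∣ L ∣                      ∎
      where open ≤-Reasoning

  matchable-across : ∀ {L K R C} → Matchable (L ─ R) (C ∩ K) → Matchable R (K ─ C) → Matchable L K
  matchable-across {L} {K} {R} {C} (f₁ , into₁ , f₁-inj) (f₂ , into₂ , f₂-inj) = f , into , f-inj
    where
    f : Fin n → Fin n
    f i = if does (i ∈? R) then f₂ i else f₁ i
    f₁∈C : ∀ i → i ∈ L → i ∉ R → f₁ i ∈ C
    f₁∈C i i∈L i∉R = proj₁ (x∈p∩q⁻ C K (proj₁ (into₁ i (x∈p∧x∉q⇒x∈p─q i∈L i∉R))))
    f₂∉C : ∀ i → i ∈ R → f₂ i ∉ C
    f₂∉C i i∈R = x∈p─q⇒x∉q K C (proj₁ (into₂ i i∈R))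
    into : ∀ i → i ∈ L → f i ∈ K × E i (f i) ≡ true
    into i i∈L with i ∈? R
    ... | yes i∈R = Prod.map₁ (p─q⊆p K C) (into₂ i i∈R)
    ... | no  i∉R = Prod.map₁ (proj₂ ∘ x∈p∩q⁻ C K) (into₁ i (x∈p∧x∉q⇒x∈p─q i∈L i∉R))
    f-inj : ∀ i j → i ∈ L → j ∈ L → f i ≡ f j → i ≡ j
    f-inj i j i∈L j∈L fi≡fj with i ∈? R | j ∈? R
    ... | yes i∈R | yes j∈R = f₂-inj i j i∈R j∈R fi≡fj
    ... | no  i∉R | no  j∉R = f₁-inj i j (x∈p∧x∉q⇒x∈p─q i∈L i∉R) (x∈p∧x∉q⇒x∈p─q j∈L j∉R) fi≡fj
    ... | yes i∈R | no  j∉R = contradiction (subst (_∈ C) (sym fi≡fj) (f₁∈C j j∈L j∉R)) (f₂∉C i i∈R)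
    ... | no  i∉R | yes j∈R = contradiction (subst (_∈ C) fi≡fj (f₁∈C i i∈L i∉R)) (f₂∉C j j∈R)

  deficient-isolated : ∀ {L K u} → u ∈ L → ¬ (∃ λ v → v ∈ K × E u v ≡ true) → DeficientCover L K
  deficient-isolated {L} {K} {u} u∈L isolated = L - u , ⊥ , cov , size
    where
    cov : CoversWithin L K (L - u) ⊥
    cov i j i∈L j∈K e with i ≟ u
    ... | yes refl = contradiction (j , j∈K , e) isolated
    ... | no  i≢u  = inj₁ (x∈p∧x≢y⇒x∈p-y i∈L i≢u)
    size : ∣ L - u ∣ + ∣ ⊥ {n} ∣ < ∣ L ∣
    size = begin-strict
      ∣ L - u ∣ + ∣ ⊥ {n} ∣ ≡⟨ cong (∣ L - u ∣ +_) (∣⊥∣≡0 n) ⟩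
      ∣ L - u ∣ + 0        ≡⟨ +-identityʳ _ ⟩
      ∣ L - u ∣            <⟨ x∈p⇒∣p-x∣<∣p∣ u∈L ⟩
      ∣ L ∣                ∎
      where open ≤-Reasoning

  matchable-extend : ∀ {L K u v} → v ∈ K → E u v ≡ true → Matchable (L - u) (K - v) → Matchable L K
  matchable-extend {L} {K} {u} {v} v∈K e (f , into , f-inj) = g , into′ , g-inj
    where
    g : Fin n → Fin n
    g i = if does (i ≟ u) then v else f i
    f≢v : ∀ i → i ∈ L → i ≢ u → f i ≢ v
    f≢v i i∈L i≢u = x∉⁅y⁆⇒x≢y (x∈p─q⇒x∉q K ⁅ v ⁆ (proj₁ (into i (x∈p∧x≢y⇒x∈p-y i∈L i≢u))))
    into′ : ∀ i → i ∈ L → g i ∈ K × E i (g i) ≡ true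
    into′ i i∈L with i ≟ u
    ... | yes refl = v∈K , e
    ... | no  i≢u  = Prod.map₁ (p─q⊆p K ⁅ v ⁆) (into i (x∈p∧x≢y⇒x∈p-y i∈L i≢u))
    g-inj : ∀ i j → i ∈ L → j ∈ L → g i ≡ g j → i ≡ j
    g-inj i j i∈L j∈L gi≡gj with i ≟ u | j ≟ u
    ... | yes refl | yes refl = refl
    ... | no  i≢u  | no  j≢u  = f-inj i j (x∈p∧x≢y⇒x∈p-y i∈L i≢u) (x∈p∧x≢y⇒x∈p-y j∈L j≢u) gi≡gj
    ... | yes refl | no  j≢u  = contradiction (sym gi≡gj) (f≢v j j∈L j≢u)
    ... | no  i≢u  | yes refl = contradiction gi≡gj (f≢v i i∈L i≢u)

  critical-extend : ∀ {L K u v} → u ∈ L → DeficientCover (L - u) (K - v) → CriticalCover L K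
  critical-extend {L} {K} {u} {v} u∈L (R₂ , C₂ , cov₂ , small₂) = R , C , cov , size , R⊆L , (u , u∈R) , ∣R∣<∣L∣
    where
    R : Subset n
    R = ⁅ u ⁆ ∪ R₂ ∩ L
    C : Subset n
    C = ⁅ v ⁆ ∪ C₂
    u∈R : u ∈ R
    u∈R = x∈p∪q⁺ (inj₁ (x∈⁅x⁆ u))
    cov : CoversWithin L K R C
    cov i j i∈L j∈K e with i ≟ u | j ≟ v
    ... | yes refl | _        = inj₁ u∈R
    ... | no  _    | yes refl = inj₂ (x∈p∪q⁺ (inj₁ (x∈⁅x⁆ v)))
    ... | no  i≢u  | no  j≢v  =
      Sum.map (λ i∈R₂ → x∈p∪q⁺ (inj₂ (x∈p∩q⁺ (i∈R₂ , i∈L)))) (λ j∈C₂ → x∈p∪q⁺ (inj₂ j∈C₂))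
              (cov₂ i j (x∈p∧x≢y⇒x∈p-y i∈L i≢u) (x∈p∧x≢y⇒x∈p-y j∈K j≢v) e)
    R⊆L : R ⊆ L
    R⊆L {i} i∈R with x∈p∪q⁻ ⁅ u ⁆ (R₂ ∩ L) i∈R
    ... | inj₁ i∈⁅u⁆ = subst (_∈ L) (sym (x∈⁅y⁆⇒x≡y u i∈⁅u⁆)) u∈L
    ... | inj₂ i∈R₂∩L = proj₂ (x∈p∩q⁻ R₂ L i∈R₂∩L)
    open ≤-Reasoning
    ∣R∣≤ : ∣ R ∣ ≤ suc ∣ R₂ ∣
    ∣R∣≤ = ≤-trans (∣⁅x⁆∪p∣≤1+∣p∣ u (R₂ ∩ L)) (s≤s (∣p∩q∣≤∣p∣ R₂ L))
    ∣C∣≤ : ∣ C ∣ ≤ suc ∣ C₂ ∣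
    ∣C∣≤ = ∣⁅x⁆∪p∣≤1+∣p∣ v C₂
    size : ∣ R ∣ + ∣ C ∣ ≤ ∣ L ∣
    size = begin
      ∣ R ∣ + ∣ C ∣                 ≤⟨ +-mono-≤ ∣R∣≤ ∣C∣≤ ⟩
      suc ∣ R₂ ∣ + suc ∣ C₂ ∣       ≡⟨ cong suc (+-suc (∣ R₂ ∣) (∣ C₂ ∣)) ⟩
      suc (suc (∣ R₂ ∣ + ∣ C₂ ∣))   ≤⟨ s≤s small₂ ⟩
      suc ∣ L - u ∣                ≤⟨ x∈p⇒∣p-x∣<∣p∣ u∈L ⟩
      ∣ L ∣                        ∎
    ∣R∣<∣L∣ : ∣ R ∣ < ∣ L ∣
    ∣R∣<∣L∣ = begin-strict
      ∣ R ∣                   ≤⟨ ∣R∣≤ ⟩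
      suc ∣ R₂ ∣              ≤⟨ s≤s (m≤m+n (∣ R₂ ∣) (∣ C₂ ∣)) ⟩
      suc (∣ R₂ ∣ + ∣ C₂ ∣)   <⟨ s≤s small₂ ⟩
      suc ∣ L - u ∣           ≤⟨ x∈p⇒∣p-x∣<∣p∣ u∈L ⟩
      ∣ L ∣                   ∎

  matchable-or-deficient : ∀ L K → Matchable L K ⊎ DeficientCover L K
  matchable-or-deficient L K = go (suc ∣ L ∣) L K ≤-refl
    where
    go : ∀ k L K → ∣ L ∣ < k → Matchable L K ⊎ DeficientCover L K
    go (suc k) L K (s≤s ∣L∣≤k) with criticalCover? L K
    ... | yes (R , C , cov , tight , R⊆L , (x , x∈R) , ∣R∣<∣L∣)
      with go k (L ─ R) (C ∩ K) (<-≤-trans (p∩q≢∅⇒∣p─q∣<∣p∣ L R (x , x∈p∩q⁺ (R⊆L x∈R , x∈R))) ∣L∣≤k)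
         | go k R (K ─ C) (<-≤-trans ∣R∣<∣L∣ ∣L∣≤k)
    ...   | inj₂ outside-deficient | _                     = inj₂ (deficient-outside cov R⊆L outside-deficient)
    ...   | inj₁ _                 | inj₂ inside-deficient  = inj₂ (deficient-inside cov tight inside-deficient)
    ...   | inj₁ outside-matchable | inj₁ inside-matchable  = inj₁ (matchable-across outside-matchable inside-matchable)
    go (suc k) L K (s≤s ∣L∣≤k) | no ¬critical with nonempty? L
    ... | no L-empty = inj₁ (id , (λ i i∈L → contradiction (i , i∈L) L-empty) , (λ i _ i∈L → contradiction (i , i∈L) L-empty))
    ... | yes (u , u∈L) with any? (λ v → v ∈? K ×-dec E u v ≟ᵇ true)
    ...   | no isolated = inj₂ (deficient-isolated u∈L isolated)
    ...   | yes (v , v∈K , e) with go k (L - u) (K - v) (<-≤-trans (x∈p⇒∣p-x∣<∣p∣ u∈L) ∣L∣≤k)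
    ...     | inj₁ matchable = inj₁ (matchable-extend v∈K e matchable)
    ...     | inj₂ deficient = contradiction (critical-extend u∈L deficient) ¬critical

  saturating-matching : (∀ R C → CoversWithin ⊤ ⊤ R C → n ≤ ∣ R ∣ + ∣ C ∣) →
                        Σ (Fin n → Fin n) λ f → (∀ i → E i (f i) ≡ true) × Injective _≡_ _≡_ f
  saturating-matching large with matchable-or-deficient ⊤ ⊤
  ... | inj₁ (f , into , f-inj) = f , (λ i → proj₂ (into i ∈⊤)) , f-inj _ _ ∈⊤ ∈⊤
  ... | inj₂ (R , C , cov , small) = contradiction (large R C cov) (<⇒≱ (subst (∣ R ∣ + ∣ C ∣ <_) (∣⊤∣≡n n) small))

injective⇒surjective : ∀ {n} (f : Fin n → Fin n) → Injective _≡_ _≡_ f → ∀ y → ∃ λ x → f x ≡ y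
injective⇒surjective {suc n} f f-inj y with any? (λ x → f x ≟ y)
... | yes hit  = hit
... | no  miss = contradiction (injective⇒≤ g-inj) 1+n≰n
  where
  g : Fin (suc n) → Fin n
  g x = punchOut {i = y} (miss ∘ (x ,_) ∘ sym)
  g-inj : Injective _≡_ _≡_ g
  g-inj {x} {x′} gx≡gx′ = f-inj (punchOut-injective {i = y} (miss ∘ (x ,_) ∘ sym) (miss ∘ (x′ ,_) ∘ sym) gx≡gx′)

injective⇒permutation : ∀ {n} (f : Fin n → Fin n) → Injective _≡_ _≡_ f → Permutation′ n
injective⇒permutation f f-inj = permutation f (proj₁ ∘ surj) (proj₂ ∘ surj) (λ x → f-inj (proj₂ (surj (f x))))
  where surj = injective⇒surjective f f-inj

insert-self : ∀ {m n} (i : Fin (suc m)) (j : Fin (suc n)) (π : Permutation m n) → insert i j π ⟨$⟩ʳ i ≡ j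
insert-self i j π with i ≟ i
... | yes _   = refl
... | no  i≢i = contradiction refl i≢i

-- Centrosymmetric permutations

Centrosymmetricₚ : ∀ {n} → Permutation′ n → Set
Centrosymmetricₚ σ = ∀ i → σ ⟨$⟩ʳ opposite i ≡ opposite (σ ⟨$⟩ʳ i)

_≤ₚ_ : ∀ {n} → Permutation′ n → Matrix01 n → Set
σ ≤ₚ A = ∀ i → A i (σ ⟨$⟩ʳ i) ≡ true

HasCentroPermutation : ∀ {n} → Matrix01 n → Set
HasCentroPermutation {n} A = Σ (Permutation′ n) λ σ → Centrosymmetricₚ σ × σ ≤ₚ A

does≡true⇒ : ∀ {P : Set} (p? : Dec P) → does p? ≡ true → P
does≡true⇒ (yes p) _ = p

centroPermutationMatrix⇔HasCentroPermutation : ∀ {n} {A : Matrix01 n} →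
  (Σ (Matrix01 n) λ P → IsPermutationMatrix P × Centrosymmetric P × (P ≤ₘ A)) ⇔ HasCentroPermutation A
centroPermutationMatrix⇔HasCentroPermutation {n} {A} = mk⇔ to from
  where
  to : (Σ (Matrix01 n) λ P → IsPermutationMatrix P × Centrosymmetric P × (P ≤ₘ A)) → HasCentroPermutation A
  to (P , (σ , P⇔σ) , cP , P≤A) = σ , σ-centro , λ i → P≤A i _ (graph i)
    where
    graph : ∀ i → P i (σ ⟨$⟩ʳ i) ≡ true
    graph i = Equivalence.from (P⇔σ i _) refl
    σ-centro : Centrosymmetricₚ σ
    σ-centro i = Equivalence.to (P⇔σ (opposite i) _) (trans (cP i (σ ⟨$⟩ʳ i)) (graph i))
  from : HasCentroPermutation A → Σ (Matrix01 n) λ P → IsPermutationMatrix P × Centrosymmetric P × (P ≤ₘ A)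
  from (σ , σ-centro , σ≤A) = P , (σ , λ i j → mk⇔ (does≡true⇒ (σ ⟨$⟩ʳ i ≟ j)) (dec-true (σ ⟨$⟩ʳ i ≟ j))) , cP , P≤A
    where
    P : Matrix01 n
    P i j = does (σ ⟨$⟩ʳ i ≟ j)
    cP : Centrosymmetric P
    cP i j = trans (cong (λ k → does (k ≟ opposite j)) (σ-centro i))
                   (does-⇔ (mk⇔ opposite-injective (cong opposite)) (opposite (σ ⟨$⟩ʳ i) ≟ opposite j) (σ ⟨$⟩ʳ i ≟ j))
    P≤A : P ≤ₘ A
    P≤A i j Pij = subst (λ k → A i k ≡ true) (does≡true⇒ (σ ⟨$⟩ʳ i ≟ j) Pij) (σ≤A i)

βπ-from-permutation : ∀ {n} {A : Matrix01 n} (σ : Permutation′ n) → σ ≤ₚ A → βπ-is A n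
βπ-from-permutation {n} σ σ≤A = (⊤ , ⊥ , full-rows , size) , bound
  where
  full-rows : CentroCover _ ⊤ ⊥
  full-rows = ((λ _ _ → ∈⊤) , (λ _ j∈⊥ → contradiction j∈⊥ ∉⊥)) , (λ _ _ _ → inj₁ ∈⊤)
  size : ∣ ⊤ {n} ∣ + ∣ ⊥ {n} ∣ ≡ n
  size = trans (cong₂ _+_ (∣⊤∣≡n n) (∣⊥∣≡0 n)) (+-identityʳ n)
  bound : ∀ R C → CentroCover _ R C → n ≤ ∣ R ∣ + ∣ C ∣
  bound R C (_ , cov) = injective⇒≤-cover (σ ⟨$⟩ʳ_) (Injection.injective (↔⇒↣ σ)) R C (λ i → cov i _ (σ≤A i))

-- Folding a centrosymmetric matrix of even order

module Fold (m : ℕ) where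

  fold : Fin (m + m) → Fin m
  fold i = [ id , opposite ]′ (splitAt m i)

  fold-↑ˡ : ∀ p → fold (p ↑ˡ m) ≡ p
  fold-↑ˡ p = cong [ id , opposite ]′ (splitAt-↑ˡ m p m)

  fold-opposite-↑ˡ : ∀ p → fold (opposite (p ↑ˡ m)) ≡ p
  fold-opposite-↑ˡ p = begin
    fold (opposite (p ↑ˡ m)) ≡⟨ cong fold (opposite-↑ˡ p) ⟩
    fold (m ↑ʳ opposite p)   ≡⟨ cong [ id , opposite ]′ (splitAt-↑ʳ m m (opposite p)) ⟩
    opposite (opposite p)    ≡⟨ opposite-involutive p ⟩
    p                        ∎
    where open ≡-Reasoning

  data HalfView : Fin (m + m) → Set where
    left  : ∀ p → HalfView (p ↑ˡ m)
    right : ∀ p → HalfView (opposite (p ↑ˡ m))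

  halfView : ∀ i → HalfView i
  halfView i with splitAt m i in eq
  ... | inj₁ p = subst HalfView (splitAt⁻¹-↑ˡ eq) (left p)
  ... | inj₂ q = subst HalfView i≡ (right (opposite q))
    where
    i≡ : opposite (opposite q ↑ˡ m) ≡ i
    i≡ = trans (opposite-↑ˡ (opposite q)) (trans (cong (m ↑ʳ_) (opposite-involutive q)) (splitAt⁻¹-↑ʳ eq))

  fold-opposite : ∀ i → fold (opposite i) ≡ fold i
  fold-opposite i with halfView i
  ... | left  p = trans (fold-opposite-↑ˡ p) (sym (fold-↑ˡ p))
  ... | right p = trans (cong fold (opposite-involutive (p ↑ˡ m))) (trans (fold-↑ˡ p) (sym (fold-opposite-↑ˡ p)))

  fold-≡ : ∀ i j → fold i ≡ fold j → i ≡ j ⊎ i ≡ opposite j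
  fold-≡ i j eq with halfView i | halfView j
  ... | left  p | left  q = inj₁ (cong (_↑ˡ m) (trans (sym (fold-↑ˡ p)) (trans eq (fold-↑ˡ q))))
  ... | left  p | right q = inj₂ (trans (cong (_↑ˡ m) (trans (sym (fold-↑ˡ p)) (trans eq (fold-opposite-↑ˡ q))))
                                        (sym (opposite-involutive (q ↑ˡ m))))
  ... | right p | left  q = inj₂ (cong (opposite ∘ (_↑ˡ m)) (trans (sym (fold-opposite-↑ˡ p)) (trans eq (fold-↑ˡ q))))
  ... | right p | right q = inj₁ (cong (opposite ∘ (_↑ˡ m)) (trans (sym (fold-opposite-↑ˡ p)) (trans eq (fold-opposite-↑ˡ q))))

  opposite-↑ˡ-≢ : ∀ p → opposite (p ↑ˡ m) ≢ p ↑ˡ m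
  opposite-↑ˡ-≢ p e with trans (sym (splitAt-↑ʳ m m (opposite p)))
                           (trans (cong (splitAt m) (trans (sym (opposite-↑ˡ p)) e)) (splitAt-↑ˡ m p m))
  ... | ()

  opposite-≢ : ∀ i → opposite i ≢ i
  opposite-≢ i with halfView i
  ... | left  p = opposite-↑ˡ-≢ p
  ... | right p = λ e → opposite-↑ˡ-≢ p (trans (sym e) (opposite-involutive (p ↑ˡ m)))

  unfold : Subset m → Subset (m + m)
  unfold R = R ++ reverse R

  lookup-unfold : ∀ R i → lookup (unfold R) i ≡ lookup R (fold i)
  lookup-unfold R i with halfView i
  ... | left  p = trans (lookup-++ˡ R (reverse R) p) (cong (lookup R) (sym (fold-↑ˡ p)))
  ... | right p = begin
    lookup (unfold R) (opposite (p ↑ˡ m)) ≡⟨ cong (lookup (unfold R)) (opposite-↑ˡ p) ⟩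
    lookup (unfold R) (m ↑ʳ opposite p)   ≡⟨ lookup-++ʳ R (reverse R) (opposite p) ⟩
    lookup (reverse R) (opposite p)       ≡⟨ lookup-reverse R p ⟩
    lookup R p                            ≡⟨ cong (lookup R) (fold-opposite-↑ˡ p) ⟨
    lookup R (fold (opposite (p ↑ˡ m)))   ∎
    where open ≡-Reasoning

  ∈-unfold⁺ : ∀ {R i} → fold i ∈ R → i ∈ unfold R
  ∈-unfold⁺ {R} {i} fi∈R = lookup⇒[]= i (unfold R) (trans (lookup-unfold R i) ([]=⇒lookup fi∈R))

  ∈-unfold⁻ : ∀ {R i} → i ∈ unfold R → fold i ∈ R
  ∈-unfold⁻ {R} {i} i∈R′ = lookup⇒[]= (fold i) R (trans (sym (lookup-unfold R i)) ([]=⇒lookup i∈R′))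

  unfold-opposite : ∀ R i → i ∈ unfold R → opposite i ∈ unfold R
  unfold-opposite R i i∈R′ = ∈-unfold⁺ (subst (_∈ R) (sym (fold-opposite i)) (∈-unfold⁻ i∈R′))

  ∣unfold∣ : ∀ R → ∣ unfold R ∣ ≡ ∣ R ∣ + ∣ R ∣
  ∣unfold∣ R = trans (∣p++q∣≡∣p∣+∣q∣ R (reverse R)) (cong (∣ R ∣ +_) (∣reverse[p]∣≡∣p∣ R))

module FoldMatrix (m : ℕ) (B : Matrix01 (m + m)) (cB : Centrosymmetric B) where

  open Fold m

  -- By centrosymmetry the row p ↑ˡ m stands for its whole π-orbit of rows, so only columns are
  -- merged: column q of the folded matrix is the π-orbit {q ↑ˡ m , opposite (q ↑ˡ m)}.
  folded : Matrix01 m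
  folded p q = B (p ↑ˡ m) (q ↑ˡ m) ∨ B (p ↑ˡ m) (opposite (q ↑ˡ m))

  B-opposite : ∀ i j → B (opposite i) j ≡ B i (opposite j)
  B-opposite i j = trans (cong (B (opposite i)) (sym (opposite-involutive j))) (cB i (opposite j))

  folded-↑ˡ : ∀ p j → B (p ↑ˡ m) j ≡ true → folded p (fold j) ≡ true
  folded-↑ˡ p j e with halfView j
  ... | left  q = subst (λ q′ → folded p q′ ≡ true) (sym (fold-↑ˡ q)) (cong (_∨ B (p ↑ˡ m) (opposite (q ↑ˡ m))) e)
  ... | right q = subst (λ q′ → folded p q′ ≡ true) (sym (fold-opposite-↑ˡ q))
                        (trans (cong (B (p ↑ˡ m) (q ↑ˡ m) ∨_) e) (∨-zeroʳ _))

  folded-edge : ∀ i j → B i j ≡ true → folded (fold i) (fold j) ≡ true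
  folded-edge i j e with halfView i
  ... | left  p = subst (λ p′ → folded p′ (fold j) ≡ true) (sym (fold-↑ˡ p)) (folded-↑ˡ p j e)
  ... | right p = subst₂ (λ p′ q′ → folded p′ q′ ≡ true) (sym (fold-opposite-↑ˡ p)) (fold-opposite j)
                         (folded-↑ˡ p (opposite j) (trans (sym (B-opposite (p ↑ˡ m) j)) e))

  unfold-cover : ∀ R C → Covers folded R C → CentroCover B (unfold R) (unfold C)
  unfold-cover R C cov = (unfold-opposite R , unfold-opposite C) ,
    λ i j e → Sum.map ∈-unfold⁺ ∈-unfold⁺ (cov (fold i) (fold j) (folded-edge i j e))

  folded-cover-bound : (∀ R C → CentroCover B R C → m + m ≤ ∣ R ∣ + ∣ C ∣) →
                       ∀ R C → Covers folded R C → m ≤ ∣ R ∣ + ∣ C ∣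
  folded-cover-bound large R C cov = m+m≤n+n⇒m≤n (begin
    m + m                                    ≤⟨ large (unfold R) (unfold C) (unfold-cover R C cov) ⟩
    ∣ unfold R ∣ + ∣ unfold C ∣              ≡⟨ cong₂ _+_ (∣unfold∣ R) (∣unfold∣ C) ⟩
    (∣ R ∣ + ∣ R ∣) + (∣ C ∣ + ∣ C ∣)        ≡⟨ interchange +-commutativeSemigroup (∣ R ∣) (∣ R ∣) (∣ C ∣) (∣ C ∣) ⟩
    (∣ R ∣ + ∣ C ∣) + (∣ R ∣ + ∣ C ∣)        ∎)
    where open ≤-Reasoning

  module _ (τ : Fin m → Fin m) (τ-inj : Injective _≡_ _≡_ τ) (matched : ∀ p → folded p (τ p) ≡ true) where

    matchedColumn : ∀ p → Σ (Fin (m + m)) λ j → B (p ↑ˡ m) j ≡ true × fold j ≡ τ p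
    matchedColumn p with B (p ↑ˡ m) (τ p ↑ˡ m) in e
    ... | true  = τ p ↑ˡ m , e , fold-↑ˡ (τ p)
    ... | false = opposite (τ p ↑ˡ m) , trans (sym (cong (_∨ B (p ↑ˡ m) (opposite (τ p ↑ˡ m))) e)) (matched p) ,
                  fold-opposite-↑ˡ (τ p)

    column : Fin m → Fin (m + m)
    column p = proj₁ (matchedColumn p)

    B-column : ∀ p → B (p ↑ˡ m) (column p) ≡ true
    B-column p = proj₁ (proj₂ (matchedColumn p))

    fold-column : ∀ p → fold (column p) ≡ τ p
    fold-column p = proj₂ (proj₂ (matchedColumn p))

    σ : Fin (m + m) → Fin (m + m)
    σ i = [ column , opposite ∘ column ∘ opposite ]′ (splitAt m i)

    σ-↑ˡ : ∀ p → σ (p ↑ˡ m) ≡ column p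
    σ-↑ˡ p = cong [ column , opposite ∘ column ∘ opposite ]′ (splitAt-↑ˡ m p m)

    σ-opposite-↑ˡ : ∀ p → σ (opposite (p ↑ˡ m)) ≡ opposite (column p)
    σ-opposite-↑ˡ p = begin
      σ (opposite (p ↑ˡ m))                      ≡⟨ cong σ (opposite-↑ˡ p) ⟩
      σ (m ↑ʳ opposite p)                        ≡⟨ cong [ column , opposite ∘ column ∘ opposite ]′ (splitAt-↑ʳ m m (opposite p)) ⟩
      opposite (column (opposite (opposite p)))  ≡⟨ cong (opposite ∘ column) (opposite-involutive p) ⟩
      opposite (column p)                        ∎
      where open ≡-Reasoning

    σ-opposite : ∀ i → σ (opposite i) ≡ opposite (σ i)
    σ-opposite i with halfView i
    ... | left  p = trans (σ-opposite-↑ˡ p) (cong opposite (sym (σ-↑ˡ p)))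
    ... | right p = begin
      σ (opposite (opposite (p ↑ˡ m)))  ≡⟨ cong σ (opposite-involutive (p ↑ˡ m)) ⟩
      σ (p ↑ˡ m)                        ≡⟨ σ-↑ˡ p ⟩
      column p                          ≡⟨ opposite-involutive (column p) ⟨
      opposite (opposite (column p))    ≡⟨ cong opposite (σ-opposite-↑ˡ p) ⟨
      opposite (σ (opposite (p ↑ˡ m)))  ∎
      where open ≡-Reasoning

    σ-edge : ∀ i → B i (σ i) ≡ true
    σ-edge i with halfView i
    ... | left  p = trans (cong (B (p ↑ˡ m)) (σ-↑ˡ p)) (B-column p)
    ... | right p = trans (cong (B (opposite (p ↑ˡ m))) (σ-opposite-↑ˡ p)) (trans (cB (p ↑ˡ m) (column p)) (B-column p))

    fold-σ : ∀ i → fold (σ i) ≡ τ (fold i)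
    fold-σ i with halfView i
    ... | left  p = trans (cong fold (σ-↑ˡ p)) (trans (fold-column p) (cong τ (sym (fold-↑ˡ p))))
    ... | right p = begin
      fold (σ (opposite (p ↑ˡ m)))   ≡⟨ cong fold (σ-opposite-↑ˡ p) ⟩
      fold (opposite (column p))     ≡⟨ fold-opposite (column p) ⟩
      fold (column p)                ≡⟨ fold-column p ⟩
      τ p                            ≡⟨ cong τ (fold-opposite-↑ˡ p) ⟨
      τ (fold (opposite (p ↑ˡ m)))   ∎
      where open ≡-Reasoning

    σ-inj : Injective _≡_ _≡_ σ
    σ-inj {i} {j} σi≡σj with fold-≡ i j (τ-inj (trans (sym (fold-σ i)) (trans (cong fold σi≡σj) (fold-σ j))))
    ... | inj₁ i≡j = i≡j
    ... | inj₂ refl = contradiction (trans (sym (σ-opposite j)) σi≡σj) (opposite-≢ (σ j))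

    unfold-matching : HasCentroPermutation B
    unfold-matching = injective⇒permutation σ σ-inj , σ-opposite , σ-edge

  centroPermutation-from-covers : (∀ R C → CentroCover B R C → m + m ≤ ∣ R ∣ + ∣ C ∣) → HasCentroPermutation B
  centroPermutation-from-covers large =
    let τ , matched , τ-inj = König.saturating-matching folded
                                (λ R C cov → folded-cover-bound large R C (λ i j → cov i j ∈⊤ ∈⊤))
    in  unfold-matching τ τ-inj matched

centroPermutation-even⇔ : ∀ m {B : Matrix01 (m + m)} → Centrosymmetric B → HasCentroPermutation B ⇔ βπ-is B (m + m)
centroPermutation-even⇔ m {B} cB = mk⇔
  (λ (σ , _ , σ≤B) → βπ-from-permutation σ σ≤B)
  (FoldMatrix.centroPermutation-from-covers m B cB ∘ proj₂)

-- Matrices of odd order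

data CentreView (m : ℕ) : Fin (suc (m + m)) → Set where
  centre : CentreView m (mid m)
  off    : ∀ k → CentreView m (punchIn (mid m) k)

centreView : ∀ m x → CentreView m x
centreView m x with mid m ≟ x
... | yes refl  = centre
... | no  mid≢x = subst (CentreView m) (punchIn-punchOut mid≢x) (off (punchOut mid≢x))

opposite-fixed⇒mid : ∀ m x → opposite x ≡ x → x ≡ mid m
opposite-fixed⇒mid m x x-fixed with centreView m x
... | centre = refl
... | off k  = contradiction (punchIn-injective (mid m) _ _ (begin
  punchIn (mid m) (opposite k)  ≡⟨ opposite-punchIn-mid m k ⟨
  opposite (punchIn (mid m) k)  ≡⟨ x-fixed ⟩
  punchIn (mid m) k             ∎)) (Fold.opposite-≢ m k)
  where open ≡-Reasoning

deleteMid-centrosymmetric : ∀ m {A : Matrix01 (suc (m + m))} → Centrosymmetric A → Centrosymmetric (deleteMid m A)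
deleteMid-centrosymmetric m {A} cA i j =
  trans (sym (cong₂ A (opposite-punchIn-mid m i) (opposite-punchIn-mid m j))) (cA (punchIn (mid m) i) (punchIn (mid m) j))

module _ (m : ℕ) {A : Matrix01 (suc (m + m))} where

  private
    pI : Fin (m + m) → Fin (suc (m + m))
    pI = punchIn (mid m)

  centroPermutation-restrict : HasCentroPermutation A → A (mid m) (mid m) ≡ true × HasCentroPermutation (deleteMid m A)
  centroPermutation-restrict (σ , σ-centro , σ≤A) = subst (λ k → A (mid m) k ≡ true) σ-mid (σ≤A (mid m)) , τ , τ-centro , τ≤A′
    where
    open ≡-Reasoning
    σ-mid : σ ⟨$⟩ʳ mid m ≡ mid m
    σ-mid = opposite-fixed⇒mid m _ (trans (sym (σ-centro (mid m))) (cong (σ ⟨$⟩ʳ_) (opposite-mid m)))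
    τ : Permutation′ (m + m)
    τ = remove (mid m) σ
    σ-pI : ∀ k → σ ⟨$⟩ʳ pI k ≡ pI (τ ⟨$⟩ʳ k)
    σ-pI k = trans (punchIn-permute σ (mid m) k) (cong (λ c → punchIn c (τ ⟨$⟩ʳ k)) σ-mid)
    τ-centro : Centrosymmetricₚ τ
    τ-centro k = punchIn-injective (mid m) _ _ (begin
      pI (τ ⟨$⟩ʳ opposite k)       ≡⟨ σ-pI (opposite k) ⟨
      σ ⟨$⟩ʳ pI (opposite k)       ≡⟨ cong (σ ⟨$⟩ʳ_) (opposite-punchIn-mid m k) ⟨
      σ ⟨$⟩ʳ opposite (pI k)       ≡⟨ σ-centro (pI k) ⟩
      opposite (σ ⟨$⟩ʳ pI k)       ≡⟨ cong opposite (σ-pI k) ⟩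
      opposite (pI (τ ⟨$⟩ʳ k))     ≡⟨ opposite-punchIn-mid m (τ ⟨$⟩ʳ k) ⟩
      pI (opposite (τ ⟨$⟩ʳ k))     ∎)
    τ≤A′ : τ ≤ₚ deleteMid m A
    τ≤A′ k = subst (λ l → A (pI k) l ≡ true) (σ-pI k) (σ≤A (pI k))

  centroPermutation-extend : A (mid m) (mid m) ≡ true × HasCentroPermutation (deleteMid m A) → HasCentroPermutation A
  centroPermutation-extend (A-centre , τ , τ-centro , τ≤A′) = σ , σ-centro , σ≤A
    where
    open ≡-Reasoning
    σ : Permutation′ (suc (m + m))
    σ = insert (mid m) (mid m) τ
    σ-mid : σ ⟨$⟩ʳ mid m ≡ mid m
    σ-mid = insert-self (mid m) (mid m) τ
    σ-pI : ∀ k → σ ⟨$⟩ʳ pI k ≡ pI (τ ⟨$⟩ʳ k)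
    σ-pI = insert-punchIn (mid m) (mid m) τ
    σ-centro : Centrosymmetricₚ σ
    σ-centro x with centreView m x
    ... | centre = begin
      σ ⟨$⟩ʳ opposite (mid m)   ≡⟨ cong (σ ⟨$⟩ʳ_) (opposite-mid m) ⟩
      σ ⟨$⟩ʳ mid m              ≡⟨ σ-mid ⟩
      mid m                     ≡⟨ opposite-mid m ⟨
      opposite (mid m)          ≡⟨ cong opposite σ-mid ⟨
      opposite (σ ⟨$⟩ʳ mid m)   ∎
    ... | off k = begin
      σ ⟨$⟩ʳ opposite (pI k)    ≡⟨ cong (σ ⟨$⟩ʳ_) (opposite-punchIn-mid m k) ⟩
      σ ⟨$⟩ʳ pI (opposite k)    ≡⟨ σ-pI (opposite k) ⟩
      pI (τ ⟨$⟩ʳ opposite k)    ≡⟨ cong pI (τ-centro k) ⟩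
      pI (opposite (τ ⟨$⟩ʳ k))  ≡⟨ opposite-punchIn-mid m (τ ⟨$⟩ʳ k) ⟨
      opposite (pI (τ ⟨$⟩ʳ k))  ≡⟨ cong opposite (σ-pI k) ⟨
      opposite (σ ⟨$⟩ʳ pI k)    ∎
    σ≤A : σ ≤ₚ A
    σ≤A x with centreView m x
    ... | centre = trans (cong (A (mid m)) σ-mid) A-centre
    ... | off k  = trans (cong (A (pI k)) (σ-pI k)) (τ≤A′ k)

  centroPermutation-odd⇔ : HasCentroPermutation A ⇔ (A (mid m) (mid m) ≡ true × HasCentroPermutation (deleteMid m A))
  centroPermutation-odd⇔ = mk⇔ centroPermutation-restrict centroPermutation-extend

corollary2p3 : (m : ℕ) → 1 ≤ m → (A : Matrix01 (suc (m + m))) → Centrosymmetric A →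
    (Σ (Matrix01 (suc (m + m))) λ P → IsPermutationMatrix P × Centrosymmetric P × (P ≤ₘ A))
    ⇔ ((A (mid m) (mid m) ≡ true) × βπ-is (deleteMid m A) (m + m))
corollary2p3 m _ A cA =
  ⇔.trans centroPermutationMatrix⇔HasCentroPermutation
    (⇔.trans (centroPermutation-odd⇔ m {A})
      (⇔.refl ×-⇔ centroPermutation-even⇔ m (deleteMid-centrosymmetric m cA)))
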